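{- Assume $A<^*B$. The following are equivalent: (i) $A<^*_iB$; (ii) there are no $A',\lambda$ such that $A\le^*A'<^*B$, $(A',B,\lambda)\in\mathcal T$ and $\mathbf w_\lambda(A',B)>0$; (iii) there are no $A',\lambda$ such that $A\le^*A'<^*B$, $(A',B,\lambda)\in\mathcal T$, $\mathbf w_\lambda(A',B)>0$, and for every $\lambda$-closed $C\subseteq B\setminus A'$ with $C\notin\{\emptyset,B\setminus A'\}$ we have $\mathbf w_\lambda(A',A'\cup C)>0$ and $\mathbf w_\lambda(A'\cup C,B)<0$.
   Context: Fix an irrational real $\alpha\in(0,1)$. All graphs are finite simple graphs. $A\le^*B$ means $A$ is an induced subgraph of $B$; $A<^*B$ means $A\le^*B$ and $A\ne B$. $\mathcal T$ is the set of triples $(A,B,\lambda)$ with $A\le^*B$ and $\lambda$ an equivalence relation on $B\setminus A$. A set $X\subseteq B$ is $\lambda$-closed if $x\in X\cap(B\setminus A)$ implies $x/\lambda\subseteq X$. For $(A,B,\lambda)\in\mathcal T$: $\mathbf v_\lambda(A,B)=|(B\setminus A)/\lambda|$; $\mathbf e_\lambda(A,B)$ is the number of edges $e$ of $B$ with $e\not\subseteq A$ and $e\not\subseteq x/\lambda$ for every $x\in B\setminus A$; $\mathbf w_\lambda(A,B)=\mathbf v_\lambda(A,B)-\alpha\,\mathbf e_\lambda(A,B)$; for intermediate $\lambda$-closed sets these are computed with the restricted equivalence relation. $A<^*_cB$ means $A<^*B$ and $\mathbf w_\lambda(A,B)<0$ for every $\lambda$ with $(A,B,\lambda)\in\mathcal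 T$. $A\le^*_iB$ means $A\le^*B$ and $A'<^*_cB$ for every $A'$ with $A\le^*A'<^*B$; $A<^*_iB$ means $A\le^*_iB$ and $A\ne B$. -}

module Defs where

open import Data.Nat using (ℕ; zero; suc)
open import Data.Nat using (_≤ᵇ_; _<ᵇ_)
open import Data.Nat.ListAction using (sum)
open import Data.Bool using (Bool; true; false; T; _∧_; not; if_then_else_)
open import Data.Fin using (Fin; toℕ)
open import Data.Fin.Subset using (Subset; _∈_; _∉_; _⊆_; _⊂_; _∪_; _─_; ⊤; ⊥)
open import Data.Vec using (lookup)
open import Data.List using (List; allFin; map)
open import Data.Integer using (+_)
open import Data.Rational using (ℚ; _/_; _*_; _<_; _≤_; 0ℚ; 1ℚ)
open import Data.Product using (Σ; ∃; _×_; _,_)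
open import Relation.Nullary using (¬_)
open import Relation.Unary using (Decidable)
open import Relation.Binary.PropositionalEquality using (_≡_; _≢_)

-- The irrational parameter α ∈ (0,1), given as a Dedekind cut:
-- below q  means  q < α.

record IrrationalCut : Set₁ where
  field
    below        : ℚ → Set
    below?       : Decidable below
    lower-closed : ∀ p q → p ≤ q → below q → below p
    rounded      : ∀ q → below q → ∃ λ r → q < r × below r
    -- irrationality: the upper part {q | q ≥ α} has no least element,
    -- i.e. α is not a rational number
    irrational   : ∀ q → ¬ below q → ∃ λ r → r < q × ¬ below r
    pos          : below 0ℚ
    lt-one       : ¬ below 1ℚ

open IrrationalCut public

ℕ→ℚ : ℕ → ℚ
ℕ→ℚ n = (+ n) / 1

-- v < α · e
_<α*_ : IrrationalCut → ℕ → ℕ → Set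
(α <α* v) e = ∃ λ q → below α q × ℕ→ℚ v < q * ℕ→ℚ e

-- α · e < v
_α*_<_ : IrrationalCut → ℕ → ℕ → Set
α α* e < v = ∃ λ q → ¬ below α q × q * ℕ→ℚ e < ℕ→ℚ v

-- Induced subgraphs of such a graph B are identified with subsets of its
-- vertex set (with the induced edges); so A ≤* B is A ⊆ ⊤ and
-- A ≤* A' is A ⊆ A', A <* A' is A ⊂ A' (the library's proper subset).

record Graph : Set where
  field
    n      : ℕ
    adj    : Fin n → Fin n → Bool
    sym    : ∀ x y → adj x y ≡ adj y x
    irrefl : ∀ x → adj x x ≡ false

open Graph public

_∈ᵇ_ : ∀ {n} → Fin n → Subset n → Bool
x ∈ᵇ S = lookup S x

count : ∀ {n} → (Fin n → Bool) → ℕ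
count {n} p = sum (map (λ x → if p x then 1 else 0) (allFin n))

IsEquivOn : ∀ {n} → Subset n → (Fin n → Fin n → Bool) → Set
IsEquivOn S λr =
  (∀ {x} → x ∈ S → T (λr x x)) ×
  (∀ {x y} → x ∈ S → y ∈ S → T (λr x y) → T (λr y x)) ×
  (∀ {x y z} → x ∈ S → y ∈ S → z ∈ S → T (λr x y) → T (λr y z) → T (λr x z))

InT : (B : Graph) → Subset (n B) → (Fin (n B) → Fin (n B) → Bool) → Set
InT B A λr = A ⊆ ⊤ × IsEquivOn (⊤ ─ A) λr

-- number of λ-classes of a set S: the elements of S that are the
-- least element (in the order of Fin n) of their λ-class within S
classCount : ∀ {n} → Subset n → (Fin n → Fin n → Bool) → ℕ
classCount {n} S λr =
  count (λ x → (x ∈ᵇ S) ∧ not (anyBelow x))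
  where
  anyBelow : Fin n → Bool
  anyBelow x = 1 ≤ᵇ count (λ y → (y ∈ᵇ S) ∧ (λr y x ∧ (toℕ y <ᵇ toℕ x)))

vλ : (B : Graph) → Subset (n B) → Subset (n B) → (Fin (n B) → Fin (n B) → Bool) → ℕ
vλ B X Y λr = classCount (Y ─ X) λr

eλ : (B : Graph) → Subset (n B) → Subset (n B) → (Fin (n B) → Fin (n B) → Bool) → ℕ
eλ B X Y λr =
  sum (map (λ x → count (λ y → edgeOK x y)) (allFin (n B)))
  where
  inD : Fin (n B) → Bool
  inD z = (z ∈ᵇ Y) ∧ not (z ∈ᵇ X)
  sameClass : Fin (n B) → Fin (n B) → Bool
  sameClass x y = inD x ∧ (inD y ∧ λr x y)
  edgeOK : Fin (n B) → Fin (n B) → Bool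
  edgeOK x y =
    (toℕ x <ᵇ toℕ y) ∧
    ((x ∈ᵇ Y) ∧ ((y ∈ᵇ Y) ∧ (adj B x y ∧
    (not ((x ∈ᵇ X) ∧ (y ∈ᵇ X)) ∧ not (sameClass x y)))))

-- w_λ(X,Y) > 0, i.e. α · e_λ(X,Y) < v_λ(X,Y)
wPos : IrrationalCut → (B : Graph) → Subset (n B) → Subset (n B) → (Fin (n B) → Fin (n B) → Bool) → Set
wPos α B X Y λr = α α* eλ B X Y λr < vλ B X Y λr

wNeg : IrrationalCut → (B : Graph) → Subset (n B) → Subset (n B) → (Fin (n B) → Fin (n B) → Bool) → Set
wNeg α B X Y λr = (α <α* vλ B X Y λr) (eλ B X Y λr)

-- A <*_c B  (B the whole graph, A a subset of its vertices)
_⊢_<c_ : IrrationalCut → (B : Graph) → Subset (n B) → Set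
α ⊢ B <c A = A ⊂ ⊤ × (∀ λr → InT B A λr → wNeg α B A ⊤ λr)

_⊢_≤i_ : IrrationalCut → (B : Graph) → Subset (n B) → Set
α ⊢ B ≤i A = A ⊆ ⊤ × (∀ A' → A ⊆ A' → A' ⊂ ⊤ → α ⊢ B <c A')

_⊢_<i_ : IrrationalCut → (B : Graph) → Subset (n B) → Set
α ⊢ B <i A = α ⊢ B ≤i A × A ≢ ⊤

λClosed : (B : Graph) → Subset (n B) → (Fin (n B) → Fin (n B) → Bool) → Subset (n B) → Set
λClosed B A' λr X = ∀ {x y} → x ∈ X → x ∉ A' → y ∉ A' → T (λr x y) → y ∈ X

CondII : IrrationalCut → (B : Graph) → Subset (n B) → Set
CondII α B A = ¬ (Σ (Subset (n B)) λ A' → Σ (Fin (n B) → Fin (n B) → Bool) λ λr →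
  A ⊆ A' × A' ⊂ ⊤ × InT B A' λr × wPos α B A' ⊤ λr)

CondIII : IrrationalCut → (B : Graph) → Subset (n B) → Set
CondIII α B A = ¬ (Σ (Subset (n B)) λ A' → Σ (Fin (n B) → Fin (n B) → Bool) λ λr →
  A ⊆ A' × A' ⊂ ⊤ × InT B A' λr × wPos α B A' ⊤ λr ×
  (∀ C → C ⊆ ⊤ ─ A' → λClosed B A' λr C → C ≢ ⊥ → C ≢ ⊤ ─ A' →
     wPos α B A' (A' ∪ C) λr × wNeg α B (A' ∪ C) ⊤ λr))

{-# OPTIONS --safe #-}
module Submission where

-- For A' ⊂ B the count v_λ(A', B) is positive, so w_λ(A', B) = v − α e is a
-- nonzero number (α is irrational): "w < 0 for every λ" is exactly "w > 0 for
-- no λ", which gives (i) ⇔ (ii); and (ii) ⇒ (iii) is immediate.  For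
-- (iii) ⇒ (ii) take a counterexample (A', λ) to (ii) with A' maximal.  If C is
-- λ-closed, no λ-class meets both C and B ∖ (A' ∪ C), so v_λ and e_λ are
-- additive along A' ⊆ A' ∪ C ⊆ B:  w(A', B) = w(A', A' ∪ C) + w(A' ∪ C, B).
-- For proper nonempty C maximality forces w(A' ∪ C, B) < 0, hence
-- w(A', A' ∪ C) > 0, and (A', λ) is a counterexample to (iii).

open import Defs hiding (sym)

open import Data.Bool using (Bool; true; false; T; _∧_; _∨_; not; if_then_else_)
open import Data.Bool.Properties using (T-≡; T-∧; ∧-zeroʳ; ¬-not)
open import Data.Empty using (⊥-elim)
open import Data.Fin using (Fin; toℕ) renaming (_<_ to _<ᶠ_)
open import Data.Fin.Induction using (<-wellFounded)
open import Data.Fin.Subset using (Subset; Nonempty; _∈_; _∉_; _⊆_; _⊂_; _⊃_; _∪_; _─_; ⊤; ⊥)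
open import Data.Fin.Subset.Induction using (⊃-wellFounded)
open import Data.Fin.Subset.Properties
  using (_∈?_; ∈⊤; ⊆⊤; ⊆-trans; ⊆-antisym; p⊆p∪q; q⊆p∪q; x∈p∪q⁻; x∈p∪q⁺; ∪-comm;
         x∈p∧x∉q⇒x∈p─q; p─q⊆p; p─q─r≡p─q∪r; nonempty?; Empty-unique)
open import Data.Integer using (+_)
import Data.Integer.Properties as ℤ
open import Data.List using ([]; _∷_; map; allFin)
open import Data.List.Membership.Propositional using () renaming (_∈_ to _∈ˡ_)
open import Data.List.Membership.Propositional.Properties using (∈-allFin)
open import Data.List.Properties using (map-cong)
import Data.List.Relation.Unary.Any as Any
open import Data.Nat using (ℕ; zero; suc; _+_; _≤_; _≤ᵇ_; _<ᵇ_)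
open import Data.Nat.Coprimality using (1-coprimeTo) renaming (sym to coprime-sym)
open import Data.Nat.ListAction using (sum)
import Data.Nat.Properties as ℕ
open import Algebra.Properties.CommutativeSemigroup ℕ.+-commutativeSemigroup using (interchange)
open import Data.Product using (∃; _×_; _,_; proj₂)
open import Data.Rational as ℚ using (1ℚ; mkℚ; _*_; _<_; NonNegative; Positive; 1/_)
open import Data.Rational.Properties
  using (normalize-coprime; ≤-total; <-irrefl; <-trans; <-≤-trans; ≤-<-trans; ≮⇒≥; _<?_; +-mono-≤-<;
         *-monoʳ-≤-nonNeg; *-monoˡ-<-pos; *-assoc; *-inverseˡ; *-identityʳ; *-distribˡ-+;
         pos⇒nonZero; positive⁻¹)
open import Data.Sum using (_⊎_; inj₁; inj₂; [_,_])
open import Data.Vec using (_∷_; here; there)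
open import Data.Vec.Properties using (lookup-zipWith; []=⇒lookup; lookup⇒[]=)
open import Function using (_∘_; id)
open import Function.Bundles using (_⇔_; mk⇔; Equivalence)
open import Induction.WellFounded using (Acc; acc)
open import Relation.Binary.PropositionalEquality
  using (_≡_; _≢_; refl; sym; trans; cong; cong₂; subst; subst₂; module ≡-Reasoning)
open import Relation.Nullary using (¬_; Dec; yes; no; contradiction)
open import Relation.Nullary.Decidable using (decidable-stable)

ℕ→ℚ≡mkℚ : ∀ n → ℕ→ℚ n ≡ mkℚ (+ n) 0 (coprime-sym (1-coprimeTo n))
ℕ→ℚ≡mkℚ n = normalize-coprime (coprime-sym (1-coprimeTo n))

ℕ→ℚ-homo-+ : ∀ m n → ℕ→ℚ (m + n) ≡ ℕ→ℚ m ℚ.+ ℕ→ℚ n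
ℕ→ℚ-homo-+ m n
  rewrite ℕ→ℚ≡mkℚ m | ℕ→ℚ≡mkℚ n | ℕ.*-identityʳ m | ℕ.*-identityʳ n | ℤ.+◃n≡+n m | ℤ.+◃n≡+n n = refl

ℕ→ℚ-nonNeg : ∀ n → NonNegative (ℕ→ℚ n)
ℕ→ℚ-nonNeg n rewrite ℕ→ℚ≡mkℚ n = _

ℕ→ℚ-pos : ∀ n → Positive (ℕ→ℚ (suc n))
ℕ→ℚ-pos n rewrite ℕ→ℚ≡mkℚ (suc n) = _

module _ (α : IrrationalCut) where

  below≤¬below : ∀ {p q} → below α p → ¬ below α q → p ℚ.≤ q
  below≤¬below {p} {q} p<α α≤q with ≤-total q p
  ... | inj₁ q≤p = contradiction (lower-closed α q p q≤p p<α) α≤q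
  ... | inj₂ p≤q = p≤q

  <α*⇒¬α*< : ∀ v e → (α <α* v) e → ¬ (α α* e < v)
  <α*⇒¬α*< v e (p , p<α , v<pe) (q , α≤q , qe<v) = <-irrefl refl (<-trans v<pe (≤-<-trans pe≤qe qe<v))
    where
    instance _ = ℕ→ℚ-nonNeg e
    pe≤qe : p * ℕ→ℚ e ℚ.≤ q * ℕ→ℚ e
    pe≤qe = *-monoʳ-≤-nonNeg (ℕ→ℚ e) (below≤¬below p<α α≤q)

  -- v / e is rational, hence strictly on one side of α (for e = 0 this needs v ≠ 0).
  <α*⊎α*< : ∀ v e → 1 ≤ v → (α <α* v) e ⊎ α α* e < v
  <α*⊎α*< (suc v) zero _ = inj₂ (1ℚ , lt-one α , positive⁻¹ (ℕ→ℚ (suc v)) {{ℕ→ℚ-pos v}})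
  <α*⊎α*< v (suc e) _ = side (below? α r)
    where
    E = ℕ→ℚ (suc e)
    instance
      _ = ℕ→ℚ-pos e
      _ = pos⇒nonZero E
    r = ℕ→ℚ v * 1/ E
    rE≡v : r * E ≡ ℕ→ℚ v
    rE≡v = begin
      ℕ→ℚ v * 1/ E * E     ≡⟨ *-assoc (ℕ→ℚ v) (1/ E) E ⟩
      ℕ→ℚ v * (1/ E * E)   ≡⟨ cong (ℕ→ℚ v *_) (*-inverseˡ E) ⟩
      ℕ→ℚ v * 1ℚ           ≡⟨ *-identityʳ (ℕ→ℚ v) ⟩
      ℕ→ℚ v                ∎
      where open ≡-Reasoning
    side : Dec (below α r) → (α <α* v) (suc e) ⊎ α α* (suc e) < v
    side (yes r<α) with rounded α r r<α
    ... | s , r<s , s<α = inj₁ (s , s<α , subst (_< s * E) rE≡v (*-monoˡ-<-pos E r<s))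
    side (no α≤r) with irrational α r α≤r
    ... | s , s<r , α≤s = inj₂ (s , α≤s , subst (s * E <_) rE≡v (*-monoˡ-<-pos E s<r))

  α*<-cancelʳ : ∀ v₁ v₂ e₁ e₂ → α α* (e₁ + e₂) < (v₁ + v₂) → (α <α* v₂) e₂ → α α* e₁ < v₁
  α*<-cancelʳ v₁ v₂ e₁ e₂ (q , α≤q , q[e₁+e₂]<v₁+v₂) (p , p<α , v₂<pe₂) with q * ℕ→ℚ e₁ <? ℕ→ℚ v₁
  ... | yes qe₁<v₁ = q , α≤q , qe₁<v₁
  ... | no  qe₁≮v₁ = contradiction (<-trans sum< (+-mono-≤-< (≮⇒≥ qe₁≮v₁) v₂<qe₂)) (<-irrefl refl)
    where
    instance _ = ℕ→ℚ-nonNeg e₂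
    v₂<qe₂ : ℕ→ℚ v₂ < q * ℕ→ℚ e₂
    v₂<qe₂ = <-≤-trans v₂<pe₂ (*-monoʳ-≤-nonNeg (ℕ→ℚ e₂) (below≤¬below p<α α≤q))
    sum< : q * ℕ→ℚ e₁ ℚ.+ q * ℕ→ℚ e₂ < ℕ→ℚ v₁ ℚ.+ ℕ→ℚ v₂
    sum< = subst₂ _<_ (trans (cong (q *_) (ℕ→ℚ-homo-+ e₁ e₂)) (*-distribˡ-+ q (ℕ→ℚ e₁) (ℕ→ℚ e₂)))
                      (ℕ→ℚ-homo-+ v₁ v₂) q[e₁+e₂]<v₁+v₂

x∈p─q⇒x∉q : ∀ {n} {p q : Subset n} {x} → x ∈ p ─ q → x ∉ q
x∈p─q⇒x∉q {p = _ ∷ _} {false ∷ _} here ()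
x∈p─q⇒x∉q {p = _ ∷ _} {_ ∷ _} (there x∈p─q) (there x∈q) = x∈p─q⇒x∉q x∈p─q x∈q

module _ {n : ℕ} where

  ─-split : ∀ {X Z Y : Subset n} → X ⊆ Z → Z ⊆ Y → Y ─ X ≡ (Z ─ X) ∪ (Y ─ Z)
  ─-split {X} {Z} {Y} X⊆Z Z⊆Y = ⊆-antisym split join
    where
    split : Y ─ X ⊆ (Z ─ X) ∪ (Y ─ Z)
    split {x} x∈Y─X with x ∈? Z
    ... | yes x∈Z = x∈p∪q⁺ (inj₁ (x∈p∧x∉q⇒x∈p─q x∈Z (x∈p─q⇒x∉q x∈Y─X)))
    ... | no  x∉Z = x∈p∪q⁺ (inj₂ (x∈p∧x∉q⇒x∈p─q (p─q⊆p Y X x∈Y─X) x∉Z))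
    join : (Z ─ X) ∪ (Y ─ Z) ⊆ Y ─ X
    join x∈∪ with x∈p∪q⁻ (Z ─ X) (Y ─ Z) x∈∪
    ... | inj₁ x∈Z─X = x∈p∧x∉q⇒x∈p─q (Z⊆Y (p─q⊆p Z X x∈Z─X)) (x∈p─q⇒x∉q x∈Z─X)
    ... | inj₂ x∈Y─Z = x∈p∧x∉q⇒x∈p─q (p─q⊆p Y Z x∈Y─Z) (x∈p─q⇒x∉q x∈Y─Z ∘ X⊆Z)

  p─q∪r⊆p─q : ∀ (p q r : Subset n) → p ─ (q ∪ r) ⊆ p ─ q
  p─q∪r⊆p─q p q r = subst (_⊆ p ─ q) (p─q─r≡p─q∪r p q r) (p─q⊆p (p ─ q) r)

  p⊂p∪q : ∀ {p q : Subset n} {x} → x ∈ q → x ∉ p → p ⊂ p ∪ q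
  p⊂p∪q {p} {q} x∈q x∉p = p⊆p∪q q , _ , q⊆p∪q p q x∈q , x∉p

  p∪q⊂⊤ : ∀ {p q : Subset n} → q ⊂ ⊤ ─ p → p ∪ q ⊂ ⊤
  p∪q⊂⊤ {p} {q} (_ , x , x∈⊤─p , x∉q) = ⊆⊤ , x , ∈⊤ , [ x∈p─q⇒x∉q x∈⊤─p , x∉q ] ∘ x∈p∪q⁻ p q

  ≢⊥⇒Nonempty : ∀ {p : Subset n} → p ≢ ⊥ → Nonempty p
  ≢⊥⇒Nonempty {p} p≢⊥ with nonempty? p
  ... | yes ne    = ne
  ... | no  empty = contradiction (Empty-unique empty) p≢⊥

  ⊆∧≢⇒⊂ : ∀ {p q : Subset n} → p ⊆ q → p ≢ q → p ⊂ q
  ⊆∧≢⇒⊂ {p} {q} p⊆q p≢q with nonempty? (q ─ p)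
  ... | yes (x , x∈q─p) = p⊆q , x , p─q⊆p q p x∈q─p , x∈p─q⇒x∉q x∈q─p
  ... | no  empty       = contradiction (⊆-antisym p⊆q q⊆p) p≢q
    where
    q⊆p : q ⊆ p
    q⊆p {x} x∈q = decidable-stable (x ∈? p) (λ x∉p → empty (x , x∈p∧x∉q⇒x∈p─q x∈q x∉p))

  ∈ᵇ⇒∈ : ∀ {S : Subset n} {x} → (x ∈ᵇ S) ≡ true → x ∈ S
  ∈ᵇ⇒∈ {S} {x} = lookup⇒[]= x S

  ∈ᵇ⇒∉ : ∀ {S : Subset n} {x} → (x ∈ᵇ S) ≡ false → x ∉ S
  ∈ᵇ⇒∉ x∉S x∈S with () ← trans (sym x∉S) ([]=⇒lookup x∈S)

  T⇒∈ : ∀ {S : Subset n} {x} → T (x ∈ᵇ S) → x ∈ S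
  T⇒∈ = ∈ᵇ⇒∈ ∘ Equivalence.to T-≡

  ∈ᵇ-∪ : ∀ (S₁ S₂ : Subset n) x → (x ∈ᵇ (S₁ ∪ S₂)) ≡ (x ∈ᵇ S₁) ∨ (x ∈ᵇ S₂)
  ∈ᵇ-∪ S₁ S₂ x = lookup-zipWith _∨_ x S₁ S₂

𝟙 : Bool → ℕ
𝟙 b = if b then 1 else 0

𝟙-∧-split : ∀ g {a b c} → 𝟙 a ≡ 𝟙 b + 𝟙 c → 𝟙 (g ∧ a) ≡ 𝟙 (g ∧ b) + 𝟙 (g ∧ c)
𝟙-∧-split true  split = split
𝟙-∧-split false _     = refl

𝟙-∨-∧ : ∀ a b {c c₁ c₂} → (T a → ¬ T b) → (T a → c ≡ c₁) → (T b → c ≡ c₂) →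
        𝟙 ((a ∨ b) ∧ c) ≡ 𝟙 (a ∧ c₁) + 𝟙 (b ∧ c₂)
𝟙-∨-∧ true  true  disjoint _    _    = contradiction _ (disjoint _)
𝟙-∨-∧ true  false _        c≡c₁ _    rewrite c≡c₁ _ = sym (ℕ.+-identityʳ _)
𝟙-∨-∧ false true  _        _    c≡c₂ rewrite c≡c₂ _ = refl
𝟙-∨-∧ false false _        _    _    = refl

∧-pull : ∀ a b c q → b ∧ (c ∧ (a ∧ q)) ≡ a ∧ (b ∧ (c ∧ q))
∧-pull true  b c q = refl
∧-pull false b c q = trans (cong (b ∧_) (∧-zeroʳ c)) (∧-zeroʳ b)

module _ {A : Set} where

  sum-map-+ : ∀ (f g h : A → ℕ) → (∀ x → f x ≡ g x + h x) →
              ∀ xs → sum (map f xs) ≡ sum (map g xs) + sum (map h xs)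
  sum-map-+ f g h f≡g+h []       = refl
  sum-map-+ f g h f≡g+h (x ∷ xs) = begin
    f x + sum (map f xs)                              ≡⟨ cong₂ _+_ (f≡g+h x) (sum-map-+ f g h f≡g+h xs) ⟩
    (g x + h x) + (sum (map g xs) + sum (map h xs))   ≡⟨ interchange (g x) (h x) _ _ ⟩
    (g x + sum (map g xs)) + (h x + sum (map h xs))   ∎
    where open ≡-Reasoning

  ∈⇒≤sum-map : ∀ (f : A → ℕ) {x xs} → x ∈ˡ xs → f x ≤ sum (map f xs)
  ∈⇒≤sum-map f {xs = y ∷ ys} (Any.here refl)  = ℕ.m≤m+n (f y) _
  ∈⇒≤sum-map f {xs = y ∷ ys} (Any.there x∈ys) = ℕ.≤-trans (∈⇒≤sum-map f x∈ys) (ℕ.m≤n+m _ (f y))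

  sum-map-𝟙-pos⇒∃ : ∀ (p : A → Bool) xs → 1 ≤ sum (map (𝟙 ∘ p) xs) → ∃ λ x → T (p x)
  sum-map-𝟙-pos⇒∃ p (x ∷ xs) 1≤sum with p x in px
  ... | true  = x , Equivalence.from T-≡ px
  ... | false = sum-map-𝟙-pos⇒∃ p xs 1≤sum

module _ {n : ℕ} where

  count-cong : ∀ {p q : Fin n → Bool} → (∀ x → p x ≡ q x) → count p ≡ count q
  count-cong p≗q = cong sum (map-cong (cong 𝟙 ∘ p≗q) (allFin n))

  count-+ : ∀ {p q r : Fin n → Bool} → (∀ x → 𝟙 (p x) ≡ 𝟙 (q x) + 𝟙 (r x)) → count p ≡ count q + count r
  count-+ {p} {q} {r} split = sum-map-+ (𝟙 ∘ p) (𝟙 ∘ q) (𝟙 ∘ r) split (allFin n)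

  count-pos : ∀ (p : Fin n → Bool) {x} → T (p x) → 1 ≤ count p
  count-pos p {x} px with p x | ∈⇒≤sum-map (𝟙 ∘ p) (∈-allFin x)
  ... | true | 1≤count = 1≤count

  count-pos⇒∃ : ∀ (p : Fin n → Bool) → 1 ≤ count p → ∃ λ x → T (p x)
  count-pos⇒∃ p = sum-map-𝟙-pos⇒∃ p (allFin n)

Unrelated : ∀ {n} → (Fin n → Fin n → Bool) → Subset n → Subset n → Set
Unrelated λr S₁ S₂ = ∀ {x y} → x ∈ S₁ → y ∈ S₂ → λr x y ≡ false

module _ {n : ℕ} (λr : Fin n → Fin n → Bool) where

  precedes : Subset n → Fin n → Fin n → Bool
  precedes S x y = (y ∈ᵇ S) ∧ (λr y x ∧ (toℕ y <ᵇ toℕ x))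

  noPredecessor : Subset n → Fin n → Bool
  noPredecessor S x = not (1 ≤ᵇ count (precedes S x))

  -- classCount S λr unfolds to count (isClassMin S).
  isClassMin : Subset n → Fin n → Bool
  isClassMin S x = (x ∈ᵇ S) ∧ noPredecessor S x

  isClassMin-intro : ∀ {S x} → x ∈ S → (1 ≤ᵇ count (precedes S x)) ≡ false → T (isClassMin S x)
  isClassMin-intro x∈S noPred rewrite []=⇒lookup x∈S | noPred = _

  precedes⇒ : ∀ {S x y} → T (precedes S x y) → y ∈ S × y <ᶠ x
  precedes⇒ {S} {x} {y} y≺x with Equivalence.to T-∧ y≺x
  ... | y∈S , rel = T⇒∈ y∈S , ℕ.<ᵇ⇒< (toℕ y) (toℕ x) (proj₂ (Equivalence.to T-∧ rel))

  classCount-pos : ∀ {S x} → x ∈ S → 1 ≤ classCount S λr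
  classCount-pos {S} {x} = descend x (<-wellFounded x)
    where
    descend : ∀ x → Acc _<ᶠ_ x → x ∈ S → 1 ≤ classCount S λr
    descend x (acc smaller) x∈S with 1 ≤ᵇ count (precedes S x) in hasPred
    ... | false = count-pos (isClassMin S) (isClassMin-intro x∈S hasPred)
    ... | true with count-pos⇒∃ (precedes S x) (ℕ.≤ᵇ⇒≤ 1 _ (Equivalence.from T-≡ hasPred))
    ... | y , y≺x = let (y∈S , y<x) = precedes⇒ y≺x in descend y (smaller y<x) y∈S

  precedes-∪ : ∀ {S₁ S₂ x} → Unrelated λr S₂ S₁ → x ∈ S₁ → ∀ y → precedes (S₁ ∪ S₂) x y ≡ precedes S₁ x y
  precedes-∪ {S₁} {S₂} S₂≁S₁ x∈S₁ y rewrite ∈ᵇ-∪ S₁ S₂ y with y ∈ᵇ S₁ | y ∈ᵇ S₂ in y∈S₂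
  ... | true  | _     = refl
  ... | false | false = refl
  ... | false | true  rewrite S₂≁S₁ (∈ᵇ⇒∈ y∈S₂) x∈S₁ = refl

  classCount-∪ : ∀ {S₁ S₂} → (∀ {x} → x ∈ S₁ → x ∉ S₂) → Unrelated λr S₂ S₁ → Unrelated λr S₁ S₂ →
                 classCount (S₁ ∪ S₂) λr ≡ classCount S₁ λr + classCount S₂ λr
  classCount-∪ {S₁} {S₂} disjoint S₂≁S₁ S₁≁S₂ = count-+ λ x →
    trans (cong (λ b → 𝟙 (b ∧ noPredecessor (S₁ ∪ S₂) x)) (∈ᵇ-∪ S₁ S₂ x))
          (𝟙-∨-∧ (x ∈ᵇ S₁) (x ∈ᵇ S₂) (λ x∈S₁ x∈S₂ → disjoint (T⇒∈ x∈S₁) (T⇒∈ x∈S₂))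
                 (noPredecessor-cong (S₁ ∪ S₂) S₁ x ∘ precedes-∪ S₂≁S₁ ∘ T⇒∈)
                 (noPredecessor-cong (S₁ ∪ S₂) S₂ x ∘ precedes-∪ᶜ ∘ T⇒∈))
    where
    noPredecessor-cong : ∀ S S' x → (∀ y → precedes S x y ≡ precedes S' x y) →
                         noPredecessor S x ≡ noPredecessor S' x
    noPredecessor-cong _ _ _ = cong (λ c → not (1 ≤ᵇ c)) ∘ count-cong
    precedes-∪ᶜ : ∀ {x} → x ∈ S₂ → ∀ y → precedes (S₁ ∪ S₂) x y ≡ precedes S₂ x y
    precedes-∪ᶜ {x} x∈S₂ y = trans (cong (λ S → precedes S x y) (∪-comm S₁ S₂)) (precedes-∪ S₁≁S₂ x∈S₂ y)

-- The condition on a pair {x, y} in the definition of eλ B X Y λr, adjacency and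
-- the order x < y aside; the arguments are x ∈ X, x ∈ Y, y ∈ X, y ∈ Y and λ x y.
eλ-condition : (xX xY yX yY related : Bool) → Bool
eλ-condition xX xY yX yY r = xY ∧ (yY ∧ (not (xX ∧ yX) ∧ not ((xY ∧ not xX) ∧ ((yY ∧ not yX) ∧ r))))

data Position {n} (X Z Y : Subset n) (x : Fin n) : Bool → Bool → Bool → Set where
  outside : Position X Z Y x false false false
  inner   : Position X Z Y x true  true  true
  middle  : x ∈ Z ─ X → Position X Z Y x false true  true
  outer   : x ∈ Y ─ Z → Position X Z Y x false false true

module _ {n} {X Z Y : Subset n} (X⊆Z : X ⊆ Z) (Z⊆Y : Z ⊆ Y) where

  position : ∀ x → Position X Z Y x (x ∈ᵇ X) (x ∈ᵇ Z) (x ∈ᵇ Y)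
  position x with x ∈ᵇ X in x∈X | x ∈ᵇ Z in x∈Z | x ∈ᵇ Y in x∈Y
  ... | false | false | false = outside
  ... | true  | true  | true  = inner
  ... | false | true  | true  = middle (x∈p∧x∉q⇒x∈p─q (∈ᵇ⇒∈ x∈Z) (∈ᵇ⇒∉ x∈X))
  ... | false | false | true  = outer  (x∈p∧x∉q⇒x∈p─q (∈ᵇ⇒∈ x∈Y) (∈ᵇ⇒∉ x∈Z))
  ... | true  | false | _     = contradiction (X⊆Z (∈ᵇ⇒∈ x∈X)) (∈ᵇ⇒∉ x∈Z)
  ... | _     | true  | false = contradiction (Z⊆Y (∈ᵇ⇒∈ x∈Z)) (∈ᵇ⇒∉ x∈Y)

  module _ {λr : Fin n → Fin n → Bool}
           (Z─X≁Y─Z : Unrelated λr (Z ─ X) (Y ─ Z)) (Y─Z≁Z─X : Unrelated λr (Y ─ Z) (Z ─ X)) where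

    eλ-condition-split : ∀ {x y xX xZ xY yX yZ yY} → Position X Z Y x xX xZ xY → Position X Z Y y yX yZ yY →
      𝟙 (eλ-condition xX xY yX yY (λr x y)) ≡
      𝟙 (eλ-condition xX xZ yX yZ (λr x y)) + 𝟙 (eλ-condition xZ xY yZ yY (λr x y))
    eλ-condition-split outside    _          = refl
    eλ-condition-split inner      outside    = refl
    eλ-condition-split (middle _) outside    = refl
    eλ-condition-split (outer _)  outside    = refl
    eλ-condition-split inner      inner      = refl
    eλ-condition-split inner      (middle _) = refl
    eλ-condition-split inner      (outer _)  = refl
    eλ-condition-split (middle _) inner      = refl
    eλ-condition-split (middle _) (middle _) = sym (ℕ.+-identityʳ _)
    eλ-condition-split (middle x∈Z─X) (outer y∈Y─Z) rewrite Z─X≁Y─Z x∈Z─X y∈Y─Z = refl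
    eλ-condition-split (outer _)  inner      = refl
    eλ-condition-split (outer x∈Y─Z) (middle y∈Z─X) rewrite Y─Z≁Z─X x∈Y─Z y∈Z─X = refl
    eλ-condition-split (outer _)  (outer _)  = refl

module _ (B : Graph) (λr : Fin (n B) → Fin (n B) → Bool) where

  eλ-summand : Subset (n B) → Subset (n B) → Fin (n B) → Fin (n B) → Bool
  eλ-summand X Y x y =
    (toℕ x <ᵇ toℕ y) ∧ (adj B x y ∧ eλ-condition (x ∈ᵇ X) (x ∈ᵇ Y) (y ∈ᵇ X) (y ∈ᵇ Y) (λr x y))

  eλ≡sum-eλ-summand : ∀ X Y → eλ B X Y λr ≡ sum (map (count ∘ eλ-summand X Y) (allFin (n B)))
  eλ≡sum-eλ-summand X Y = cong sum (map-cong (λ x → count-cong λ y →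
    cong ((toℕ x <ᵇ toℕ y) ∧_) (∧-pull (adj B x y) (x ∈ᵇ Y) (y ∈ᵇ Y) _)) (allFin (n B)))

  module _ {X Z Y} (X⊆Z : X ⊆ Z) (Z⊆Y : Z ⊆ Y)
           (Z─X≁Y─Z : Unrelated λr (Z ─ X) (Y ─ Z)) (Y─Z≁Z─X : Unrelated λr (Y ─ Z) (Z ─ X)) where

    eλ-split : eλ B X Y λr ≡ eλ B X Z λr + eλ B Z Y λr
    eλ-split = begin
      eλ B X Y λr
        ≡⟨ eλ≡sum-eλ-summand X Y ⟩
      sum (map (count ∘ eλ-summand X Y) (allFin (n B)))
        ≡⟨ sum-map-+ _ _ _ (count-+ ∘ summand-split) (allFin (n B)) ⟩
      sum (map (count ∘ eλ-summand X Z) (allFin (n B))) + sum (map (count ∘ eλ-summand Z Y) (allFin (n B)))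
        ≡⟨ cong₂ _+_ (eλ≡sum-eλ-summand X Z) (eλ≡sum-eλ-summand Z Y) ⟨
      eλ B X Z λr + eλ B Z Y λr
        ∎
      where
      open ≡-Reasoning
      summand-split : ∀ x y → 𝟙 (eλ-summand X Y x y) ≡ 𝟙 (eλ-summand X Z x y) + 𝟙 (eλ-summand Z Y x y)
      summand-split x y = 𝟙-∧-split (toℕ x <ᵇ toℕ y) (𝟙-∧-split (adj B x y)
        (eλ-condition-split X⊆Z Z⊆Y Z─X≁Y─Z Y─Z≁Z─X (position X⊆Z Z⊆Y x) (position X⊆Z Z⊆Y y)))

    vλ-split : vλ B X Y λr ≡ vλ B X Z λr + vλ B Z Y λr
    vλ-split = begin
      classCount (Y ─ X) λr                          ≡⟨ cong (λ S → classCount S λr) (─-split X⊆Z Z⊆Y) ⟩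
      classCount ((Z ─ X) ∪ (Y ─ Z)) λr              ≡⟨ classCount-∪ λr disjoint Y─Z≁Z─X Z─X≁Y─Z ⟩
      classCount (Z ─ X) λr + classCount (Y ─ Z) λr  ∎
      where
      open ≡-Reasoning
      disjoint : ∀ {x} → x ∈ Z ─ X → x ∉ Y ─ Z
      disjoint x∈Z─X x∈Y─Z = x∈p─q⇒x∉q x∈Y─Z (p─q⊆p Z X x∈Z─X)

IsEquivOn-⊆ : ∀ {n} {S S' : Subset n} {λr} → S' ⊆ S → IsEquivOn S λr → IsEquivOn S' λr
IsEquivOn-⊆ S'⊆S (reflexive , symmetric , transitive) =
  reflexive ∘ S'⊆S ,
  (λ x y → symmetric (S'⊆S x) (S'⊆S y)) ,
  (λ x y z → transitive (S'⊆S x) (S'⊆S y) (S'⊆S z))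

module _ (B : Graph) {A' C : Subset (n B)} {λr : Fin (n B) → Fin (n B) → Bool}
         (C⊆⊤─A' : C ⊆ ⊤ ─ A') (closed : λClosed B A' λr C) (equiv : IsEquivOn (⊤ ─ A') λr) where

  private
    ∈∪─⇒∈ : ∀ {x} → x ∈ (A' ∪ C) ─ A' → x ∈ C × x ∉ A'
    ∈∪─⇒∈ x∈ with x∈p∪q⁻ A' C (p─q⊆p _ A' x∈)
    ... | inj₁ x∈A' = contradiction x∈A' (x∈p─q⇒x∉q x∈)
    ... | inj₂ x∈C  = x∈C , x∈p─q⇒x∉q x∈

    ∈⊤─∪⇒∉ : ∀ {y} → y ∈ ⊤ ─ (A' ∪ C) → y ∉ C × y ∉ A'
    ∈⊤─∪⇒∉ y∈ = x∈p─q⇒x∉q y∈ ∘ q⊆p∪q A' C , x∈p─q⇒x∉q y∈ ∘ p⊆p∪q C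

  closed⇒unrelated : Unrelated λr ((A' ∪ C) ─ A') (⊤ ─ (A' ∪ C))
  closed⇒unrelated x∈ y∈ =
    let (x∈C , x∉A') = ∈∪─⇒∈ x∈ ; (y∉C , y∉A') = ∈⊤─∪⇒∉ y∈
    in ¬-not λ xλy → y∉C (closed x∈C x∉A' y∉A' (Equivalence.from T-≡ xλy))

  closed⇒unrelatedᶜ : Unrelated λr (⊤ ─ (A' ∪ C)) ((A' ∪ C) ─ A')
  closed⇒unrelatedᶜ x∈ y∈ =
    let (x∉C , x∉A') = ∈⊤─∪⇒∉ x∈ ; (y∈C , y∉A') = ∈∪─⇒∈ y∈ ; (_ , λ-sym , _) = equiv
    in ¬-not λ xλy → x∉C (closed y∈C y∉A' x∉A'
         (λ-sym (x∈p∧x∉q⇒x∈p─q ∈⊤ x∉A') (C⊆⊤─A' y∈C) (Equivalence.from T-≡ xλy)))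

  wPos-closed-bottom : ∀ α → wPos α B A' ⊤ λr → wNeg α B (A' ∪ C) ⊤ λr → wPos α B A' (A' ∪ C) λr
  wPos-closed-bottom α pos =
    α*<-cancelʳ α (vλ B A' (A' ∪ C) λr) (vλ B (A' ∪ C) ⊤ λr) (eλ B A' (A' ∪ C) λr) (eλ B (A' ∪ C) ⊤ λr)
                  additive
    where
    additive : α α* (eλ B A' (A' ∪ C) λr + eλ B (A' ∪ C) ⊤ λr) < (vλ B A' (A' ∪ C) λr + vλ B (A' ∪ C) ⊤ λr)
    additive = subst₂ (λ e v → α α* e < v)
      (eλ-split B λr (p⊆p∪q C) ⊆⊤ closed⇒unrelated closed⇒unrelatedᶜ)
      (vλ-split B λr (p⊆p∪q C) ⊆⊤ closed⇒unrelated closed⇒unrelatedᶜ) pos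

module Equivalences (α : IrrationalCut) (B : Graph) (A : Subset (n B)) where

  wNeg⊎wPos : ∀ {A'} λr → A' ⊂ ⊤ → wNeg α B A' ⊤ λr ⊎ wPos α B A' ⊤ λr
  wNeg⊎wPos {A'} λr (_ , x , _ , x∉A') =
    <α*⊎α*< α (vλ B A' ⊤ λr) (eλ B A' ⊤ λr) (classCount-pos λr (x∈p∧x∉q⇒x∈p─q ∈⊤ x∉A'))

  <i⇒CondII : α ⊢ B <i A → CondII α B A
  <i⇒CondII ((_ , critical) , _) (A' , λr , A⊆A' , A'⊂⊤ , inT , pos) =
    <α*⇒¬α*< α (vλ B A' ⊤ λr) (eλ B A' ⊤ λr) (proj₂ (critical A' A⊆A' A'⊂⊤) λr inT) pos

  CondII⇒<i : A ⊂ ⊤ → CondII α B A → α ⊢ B <i A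
  CondII⇒<i (_ , x , _ , x∉A) ¬ii = (⊆⊤ , critical) , λ A≡⊤ → x∉A (subst (x ∈_) (sym A≡⊤) ∈⊤)
    where
    critical : ∀ A' → A ⊆ A' → A' ⊂ ⊤ → α ⊢ B <c A'
    critical A' A⊆A' A'⊂⊤ = A'⊂⊤ , λ λr inT →
      [ id , (λ pos → ⊥-elim (¬ii (A' , λr , A⊆A' , A'⊂⊤ , inT , pos))) ] (wNeg⊎wPos λr A'⊂⊤)

  CondII⇒CondIII : CondII α B A → CondIII α B A
  CondII⇒CondIII ¬ii (A' , λr , A⊆A' , A'⊂⊤ , inT , pos , _) = ¬ii (A' , λr , A⊆A' , A'⊂⊤ , inT , pos)

  CondIII⇒CondII : CondIII α B A → CondII α B A
  CondIII⇒CondII ¬iii (A' , λr , A⊆A' , A'⊂⊤ , inT , pos) = noPos (⊃-wellFounded A') λr A⊆A' A'⊂⊤ inT pos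
    where
    noPos : ∀ {A'} → Acc _⊃_ A' → ∀ λr → A ⊆ A' → A' ⊂ ⊤ → InT B A' λr → ¬ wPos α B A' ⊤ λr
    noPos {A'} (acc larger) λr A⊆A' A'⊂⊤ inT@(_ , equiv) pos =
      ¬iii (A' , λr , A⊆A' , A'⊂⊤ , inT , pos , splits)
      where
      splits : ∀ C → C ⊆ ⊤ ─ A' → λClosed B A' λr C → C ≢ ⊥ → C ≢ ⊤ ─ A' →
               wPos α B A' (A' ∪ C) λr × wNeg α B (A' ∪ C) ⊤ λr
      splits C C⊆⊤─A' closed C≢⊥ C≢⊤─A' = wPos-closed-bottom B C⊆⊤─A' closed equiv α pos neg , neg
        where
        A'⊂A'∪C : A' ⊂ A' ∪ C
        A'⊂A'∪C = let (_ , x∈C) = ≢⊥⇒Nonempty C≢⊥ in p⊂p∪q x∈C (x∈p─q⇒x∉q (C⊆⊤─A' x∈C))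
        A'∪C⊂⊤ : A' ∪ C ⊂ ⊤
        A'∪C⊂⊤ = p∪q⊂⊤ (⊆∧≢⇒⊂ C⊆⊤─A' C≢⊤─A')
        inT' : InT B (A' ∪ C) λr
        inT' = ⊆⊤ , IsEquivOn-⊆ (p─q∪r⊆p─q ⊤ A' C) equiv
        neg : wNeg α B (A' ∪ C) ⊤ λr
        neg = [ id , ⊥-elim ∘ noPos (larger A'⊂A'∪C) λr (⊆-trans A⊆A' (p⊆p∪q C)) A'∪C⊂⊤ inT' ]
                (wNeg⊎wPos λr A'∪C⊂⊤)

claim1p14 : (α : IrrationalCut) (B : Graph) (A : Subset (n B)) → A ⊂ ⊤ →
    ((α ⊢ B <i A) ⇔ CondII α B A) × ((α ⊢ B <i A) ⇔ CondIII α B A)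
claim1p14 α B A A⊂⊤ =
  mk⇔ <i⇒CondII (CondII⇒<i A⊂⊤) ,
  mk⇔ (CondII⇒CondIII ∘ <i⇒CondII) (CondII⇒<i A⊂⊤ ∘ CondIII⇒CondII)
  where open Equivalences α B A
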